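{- Let $p\geq 2$ and $n=2^p-1$. Then there exists a perfect code $C$ in the generalized Lucas cube $\Lambda_n(1^{n-1})$ with $|C|=\frac{2^n}{n+1}-1$, and there exists a perfect code $C$ in the generalized Lucas cube $\Lambda_n(1^{n-2})$ with $|C|=\frac{2^n}{n+1}-1$.
   Context: The hypercube $Q_n$ has as vertex set the binary strings of length $n$, two strings being adjacent if they differ in exactly one position. For a binary string $b_1\dots b_n$ and $1\le i\le n$, its $i$-th circulation is $b_i\dots b_nb_1\dots b_{i-1}$. For an integer $s\ge1$, the generalized Lucas cube $\Lambda_n(1^s)$ is the subgraph of $Q_n$ induced by the binary strings of length $n$ none of whose circulations contains $1^s$ (the string of $s$ ones) as a substring. A perfect code of a graph $G$ is a set $C$ of vertices such that every vertex of $G$ is at distance at most $1$ in $G$ from exactly one vertex of $C$. -}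

module Defs where

open import Data.Nat using (ℕ; zero; suc; _+_; _≤_)
open import Data.Bool using (Bool; true; false)
open import Data.Vec using (Vec; []; _∷_; _++_; take; drop; replicate; lookup)
open import Data.Vec.Relation.Unary.Any using (Any)
open import Data.Fin using (Fin; toℕ)
open import Data.List using (List)
open import Data.List.Relation.Unary.Unique.Propositional using (Unique)
open import Data.List.Relation.Unary.All using (All)
open import Data.List.Membership.Propositional using (_∈_)
open import Data.Product using (Σ; ∃; _×_; _,_)
open import Data.Sum using (_⊎_)
open import Relation.Binary.PropositionalEquality using (_≡_)
open import Relation.Nullary using (¬_)

BinStr : ℕ → Set
BinStr n = Vec Bool n

rotl : ∀ {n} → BinStr n → BinStr n
rotl [] = []
rotl (b ∷ bs) = Data.Vec._∷ʳ_ bs b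

rotlBy : ∀ {n} → ℕ → BinStr n → BinStr n
rotlBy zero x = x
rotlBy (suc k) x = rotlBy k (rotl x)

-- the i-th circulation b_i ... b_n b_1 ... b_{i-1}, for 1 ≤ i ≤ n,
-- indexed here by i - 1 ∈ Fin n
circulation : ∀ {n} → Fin n → BinStr n → BinStr n
circulation i x = rotlBy (toℕ i) x

data IsPrefix : ∀ {m k} → Vec Bool m → Vec Bool k → Set where
  pre[] : ∀ {k} {w : Vec Bool k} → IsPrefix [] w
  pre∷  : ∀ {m k} {u : Vec Bool m} {w : Vec Bool k} (b : Bool) →
          IsPrefix u w → IsPrefix (b ∷ u) (b ∷ w)

data IsSubstring {m : ℕ} (u : Vec Bool m) : ∀ {k} → Vec Bool k → Set where
  here  : ∀ {k} {w : Vec Bool k} → IsPrefix u w → IsSubstring u w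
  there : ∀ {k} {w : Vec Bool k} (b : Bool) → IsSubstring u w → IsSubstring u (b ∷ w)

InLucas : (n s : ℕ) → BinStr n → Set
InLucas n s x = (i : Fin n) → ¬ IsSubstring (replicate s true) (circulation i x)

Adjacent : ∀ {n} → BinStr n → BinStr n → Set
Adjacent {n} x y =
  Σ (Fin n) λ i → (¬ lookup x i ≡ lookup y i) ×
                  ((j : Fin n) → ¬ j ≡ i → lookup x j ≡ lookup y j)

-- distance at most 1 in the induced subgraph Λ_n(1^s)
-- (for vertices of an induced subgraph, distance ≤ 1 iff equal or adjacent in Q_n)
Within1 : ∀ {n} → BinStr n → BinStr n → Set
Within1 x y = x ≡ y ⊎ Adjacent x y

IsPerfectCode : (n s : ℕ) → List (BinStr n) → Set
IsPerfectCode n s C =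
  Unique C ×
  All (InLucas n s) C ×
  ((v : BinStr n) → InLucas n s v →
     Σ (BinStr n) λ c → (c ∈ C) × Within1 v c ×
       ((c' : BinStr n) → c' ∈ C → Within1 v c' → c' ≡ c))

-- Perfect codes in the generalized Lucas cubes Λ_n(1^(n-1)) and Λ_n(1^(n-2)),
-- n = 2^p - 1, p ≥ 2: the Hamming code of length n minus the all-ones string.
--
-- Label the n positions by the nonzero strings of length p.  Since each nonzero
-- syndrome (XOR of the labels at the ones of x) is the label of exactly one
-- position, each string is within distance one of exactly one codeword, i.e. of
-- syndrome 0.  For p ≥ 2, 1ⁿ is a codeword, so every other codeword has at
-- least three zeros and is a vertex of Λ_n(1^s) when n - 2 ≤ s; and for s < n
-- no vertex is within distance one of 1ⁿ, so decoding a vertex never yields 1ⁿ.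
-- Putting the unit labels last makes the code systematic, giving 2^(n-p) - 1
-- codewords.
module Submission where

open import Defs
open import Data.Nat using (ℕ; zero; suc; _≤_; _<_; _^_; _∸_; _+_; _*_; z≤n; s≤s)
open import Data.Nat.Properties
  using (+-suc; +-identityʳ; ≤-refl; ≤-trans; ≤-reflexive; n≤1+n;
         +-cancelʳ-≤; m≤n+m∸n; m≤n+m; +-monoˡ-≤; ∸-monoʳ-<; +-∸-assoc; m^n>0; ^-distribˡ-+-*; suc-injective)
open import Data.Nat.DivMod using (_/_; m*n/n≡m)
open import Data.Nat.Tactic.RingSolver using (solve-∀)
open import Data.Bool using (Bool; true; false; not; _xor_)
open import Data.Bool.Properties
  using (xor-assoc; xor-comm; xor-identityˡ; xor-same; not-involutive; not-¬; ¬-not)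
  renaming (_≟_ to _≟ᵇ_)
open import Data.Fin using (Fin; zero; suc; toℕ; inject₁)
open import Data.Fin.Properties using (toℕ-inject₁) renaming (_≟_ to _≟ᶠ_; suc-injective to fsuc-injective)
open import Data.Vec using (Vec; []; _∷_; _++_; replicate; lookup; map; zipWith; updateAt; tabulate; _∷ʳ_; splitAt)
open import Data.Vec.Properties
  using (zipWith-assoc; zipWith-comm; zipWith-identityˡ; updateAt-updateAt; updateAt-cong; updateAt-id;
         lookup∘updateAt; lookup∘updateAt′; tabulate∘lookup; tabulate-cong; ∷-injectiveʳ; ++-injectiveˡ; ≡-dec)
import Data.Vec.Relation.Unary.All as VAll
import Data.Vec.Relation.Unary.All.Properties as VAllₚ
import Data.Vec.Relation.Unary.AllPairs.Properties as VAllPairsₚ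
open import Data.Vec.Relation.Unary.AllPairs using () renaming ([] to []ᵖ; _∷_ to _∷ᵖ_)
open import Data.Vec.Relation.Unary.Any using (index) renaming (here to hereᵛ; there to thereᵛ)
open import Data.Vec.Relation.Unary.Any.Properties using (lookup-index)
open import Data.Vec.Relation.Unary.Unique.Propositional using () renaming (Unique to UniqueV)
open import Data.Vec.Relation.Unary.Unique.Propositional.Properties using (lookup-injective)
import Data.Vec.Relation.Unary.Unique.Propositional.Properties as UniqueVₚ
open import Data.Vec.Membership.Propositional using () renaming (_∈_ to _∈ᵛ_)
open import Data.Vec.Membership.Propositional.Properties using () renaming (∈-map⁺ to ∈ᵛ-map⁺; ∈-++⁺ˡ to ∈ᵛ-++⁺ˡ; ∈-++⁺ʳ to ∈ᵛ-++⁺ʳ)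
open import Data.List using (List; length) renaming ([] to []ˡ; _∷_ to _∷ˡ_; _++_ to _++ˡ_; map to mapˡ)
open import Data.List.Properties using (length-map; length-++)
open import Data.List.Membership.Propositional using (_∈_)
open import Data.List.Relation.Unary.Any using () renaming (here to hereˡ)
open import Data.List.Membership.Propositional.Properties using (∈-map⁺; ∈-map⁻; ∈-++⁺ˡ; ∈-++⁺ʳ)
import Data.List.Relation.Unary.All as LAll
import Data.List.Relation.Unary.All.Properties as LAllₚ
open import Data.List.Relation.Unary.Unique.Propositional using (Unique)
import Data.List.Relation.Unary.Unique.Propositional.Properties as Uniqueₚ
open import Data.List.Relation.Unary.AllPairs using () renaming ([] to []ˡᵖ; _∷_ to _∷ˡᵖ_)
open import Data.Product using (Σ; ∃; _×_; _,_; proj₁)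
open import Data.Sum using (_⊎_; inj₁; inj₂)
open import Data.Empty using (⊥; ⊥-elim)
open import Relation.Nullary using (¬_; yes; no)
open import Relation.Binary.PropositionalEquality
open import Function using (_∘′_)

infixl 6 _⊕_
_⊕_ : ∀ {m} → BinStr m → BinStr m → BinStr m
_⊕_ = zipWith _xor_

0s : ∀ {m} → BinStr m
0s = replicate _ false

1s : ∀ {m} → BinStr m
1s = replicate _ true

⊕-assoc : ∀ {m} (x y z : BinStr m) → (x ⊕ y) ⊕ z ≡ x ⊕ (y ⊕ z)
⊕-assoc = zipWith-assoc xor-assoc

⊕-comm : ∀ {m} (x y : BinStr m) → x ⊕ y ≡ y ⊕ x
⊕-comm = zipWith-comm xor-comm

⊕-identityˡ : ∀ {m} (x : BinStr m) → 0s ⊕ x ≡ x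
⊕-identityˡ = zipWith-identityˡ xor-identityˡ

⊕-self : ∀ {m} (x : BinStr m) → x ⊕ x ≡ 0s
⊕-self [] = refl
⊕-self (b ∷ x) = cong₂ _∷_ (xor-same b) (⊕-self x)

⊕-cancelˡ : ∀ {m} (x y : BinStr m) → x ⊕ (x ⊕ y) ≡ y
⊕-cancelˡ x y = begin
  x ⊕ (x ⊕ y)  ≡⟨ ⊕-assoc x x y ⟨
  (x ⊕ x) ⊕ y  ≡⟨ cong (_⊕ y) (⊕-self x) ⟩
  0s ⊕ y       ≡⟨ ⊕-identityˡ y ⟩
  y            ∎
  where open ≡-Reasoning

⊕≡0⇒≡ : ∀ {m} (x y : BinStr m) → x ⊕ y ≡ 0s → x ≡ y
⊕≡0⇒≡ x y x⊕y≡0 = begin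
  x            ≡⟨ ⊕-cancelˡ y x ⟨
  y ⊕ (y ⊕ x)  ≡⟨ cong (y ⊕_) (trans (⊕-comm y x) x⊕y≡0) ⟩
  y ⊕ 0s       ≡⟨ ⊕-comm y 0s ⟩
  0s ⊕ y       ≡⟨ ⊕-identityˡ y ⟩
  y            ∎
  where open ≡-Reasoning

flip : ∀ {m} → BinStr m → Fin m → BinStr m
flip x i = updateAt x i not

flip-involutive : ∀ {m} (x : BinStr m) (i : Fin m) → flip (flip x i) i ≡ x
flip-involutive x i =
  trans (updateAt-updateAt i x) (trans (updateAt-cong i not-involutive x) (updateAt-id i x))

lookup-ext : ∀ {A : Set} {m} {xs ys : Vec A m} → (∀ i → lookup xs i ≡ lookup ys i) → xs ≡ ys
lookup-ext {xs = xs} {ys} pointwise = begin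
  xs                   ≡⟨ tabulate∘lookup xs ⟨
  tabulate (lookup xs) ≡⟨ tabulate-cong pointwise ⟩
  tabulate (lookup ys) ≡⟨ tabulate∘lookup ys ⟩
  ys                   ∎
  where open ≡-Reasoning

adjacent⇒flip : ∀ {m} {x y : BinStr m} → Adjacent x y → ∃ λ i → y ≡ flip x i
adjacent⇒flip {x = x} {y} (i , differ , agree) = i , lookup-ext pointwise
  where
    pointwise : ∀ j → lookup y j ≡ lookup (flip x i) j
    pointwise j with j ≟ᶠ i
    ... | yes refl = trans (¬-not (differ ∘′ sym)) (sym (lookup∘updateAt i x))
    ... | no j≢i = trans (sym (agree j j≢i)) (sym (lookup∘updateAt′ j i j≢i x))

flip-adjacent : ∀ {m} (x : BinStr m) (i : Fin m) → Adjacent x (flip x i)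
flip-adjacent x i =
  i , (λ e → not-¬ refl (trans e (lookup∘updateAt i x))) ,
  (λ j j≢i → sym (lookup∘updateAt′ j i j≢i x))

within1-cases : ∀ {m} {x y : BinStr m} → Within1 x y → y ≡ x ⊎ ∃ λ i → y ≡ flip x i
within1-cases (inj₁ x≡y) = inj₁ (sym x≡y)
within1-cases (inj₂ adj) = inj₂ (adjacent⇒flip adj)

-- The syndrome of x with respect to labels ls: the XOR of the labels ls_i over
-- the positions i where x_i = 1 (i.e. the product with the parity-check matrix
-- whose columns are the labels).
syn : ∀ {p m} → Vec (BinStr p) m → BinStr m → BinStr p
syn [] [] = 0s
syn (l ∷ ls) (true ∷ x) = l ⊕ syn ls x
syn (l ∷ ls) (false ∷ x) = syn ls x

syn-flip : ∀ {p m} (ls : Vec (BinStr p) m) (x : BinStr m) (i : Fin m) →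
           syn ls (flip x i) ≡ syn ls x ⊕ lookup ls i
syn-flip (l ∷ ls) (true ∷ x) zero = trans (sym (⊕-cancelˡ l (syn ls x))) (⊕-comm l (l ⊕ syn ls x))
syn-flip (l ∷ ls) (false ∷ x) zero = ⊕-comm l (syn ls x)
syn-flip (l ∷ ls) (true ∷ x) (suc i) = trans (cong (l ⊕_) (syn-flip ls x i)) (sym (⊕-assoc l _ _))
syn-flip (l ∷ ls) (false ∷ x) (suc i) = syn-flip ls x i

syn-++ : ∀ {p m k} (ls : Vec (BinStr p) m) (ms : Vec (BinStr p) k) (x : BinStr m) (y : BinStr k) →
         syn (ls ++ ms) (x ++ y) ≡ syn ls x ⊕ syn ms y
syn-++ [] ms [] y = sym (⊕-identityˡ _)
syn-++ (l ∷ ls) ms (true ∷ x) y = trans (cong (l ⊕_) (syn-++ ls ms x y)) (sym (⊕-assoc l _ _))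
syn-++ (l ∷ ls) ms (false ∷ x) y = syn-++ ls ms x y

syn-map-false : ∀ {p m} (ls : Vec (BinStr p) m) (x : BinStr m) →
                syn (map (false ∷_) ls) x ≡ false ∷ syn ls x
syn-map-false [] [] = refl
syn-map-false (l ∷ ls) (true ∷ x) = cong ((false ∷ l) ⊕_) (syn-map-false ls x)
syn-map-false (l ∷ ls) (false ∷ x) = syn-map-false ls x

isOdd : ℕ → Bool
isOdd zero = false
isOdd (suc m) = not (isOdd m)

syn-map-true-ones : ∀ {p m} (ls : Vec (BinStr p) m) →
                    syn (map (true ∷_) ls) 1s ≡ isOdd m ∷ syn ls 1s
syn-map-true-ones [] = refl
syn-map-true-ones (l ∷ ls) = cong ((true ∷ l) ⊕_) (syn-map-true-ones ls)

module SyndromeDecoding {p n : ℕ} (ls : Vec (BinStr p) n)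
  (ls-injective : ∀ i j → lookup ls i ≡ lookup ls j → i ≡ j)
  (ls-nonzero : ∀ i → lookup ls i ≢ 0s)
  (ls-surjective : ∀ s → s ≢ 0s → ∃ λ i → lookup ls i ≡ s)
  where

  S : BinStr n → BinStr p
  S = syn ls

  flip-leaves-code : ∀ {x} → S x ≡ 0s → ∀ i → S (flip x i) ≢ 0s
  flip-leaves-code {x} Sx≡0 i Sfx≡0 = ls-nonzero i (begin
    lookup ls i          ≡⟨ ⊕-identityˡ _ ⟨
    0s ⊕ lookup ls i     ≡⟨ cong (_⊕ lookup ls i) Sx≡0 ⟨
    S x ⊕ lookup ls i    ≡⟨ syn-flip ls x i ⟨
    S (flip x i)         ≡⟨ Sfx≡0 ⟩
    0s                   ∎)
    where open ≡-Reasoning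

  -- Two flips of a common string at different positions are never both
  -- codewords (with flip-leaves-code: codewords are at distance at least 3).
  flips-differ : ∀ x {i j} → S (flip x i) ≡ 0s → S (flip x j) ≡ 0s → i ≡ j
  flips-differ x {i} {j} Sfi Sfj = ls-injective i j (begin
    lookup ls i                    ≡⟨ ⊕-cancelˡ (S x) _ ⟨
    S x ⊕ (S x ⊕ lookup ls i)      ≡⟨ cong (S x ⊕_) (trans (sym (syn-flip ls x i)) Sfi) ⟩
    S x ⊕ 0s                       ≡⟨ cong (S x ⊕_) (trans (sym (syn-flip ls x j)) Sfj) ⟨
    S x ⊕ (S x ⊕ lookup ls j)      ≡⟨ ⊕-cancelˡ (S x) _ ⟩
    lookup ls j                    ∎)
    where open ≡-Reasoning

  decode : ∀ v → ∃ λ c → S c ≡ 0s × Within1 v c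
  decode v with ≡-dec _≟ᵇ_ (S v) 0s
  ... | yes Sv≡0 = v , Sv≡0 , inj₁ refl
  ... | no Sv≢0 with ls-surjective (S v) Sv≢0
  ...   | i , lᵢ≡Sv = flip v i , Sflip≡0 , inj₂ (flip-adjacent v i)
    where
      Sflip≡0 : S (flip v i) ≡ 0s
      Sflip≡0 = trans (syn-flip ls v i) (trans (cong (S v ⊕_) lᵢ≡Sv) (⊕-self (S v)))

  decode-unique : ∀ {v c c'} → S c ≡ 0s → S c' ≡ 0s → Within1 v c → Within1 v c' → c' ≡ c
  decode-unique {v} Sc Sc' vc vc' with within1-cases vc | within1-cases vc'
  ... | inj₁ refl | inj₁ refl = refl
  ... | inj₁ refl | inj₂ (j , refl) = ⊥-elim (flip-leaves-code Sc j Sc')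
  ... | inj₂ (i , refl) | inj₁ refl = ⊥-elim (flip-leaves-code Sc' i Sc)
  ... | inj₂ (i , refl) | inj₂ (j , refl) = cong (flip v) (flips-differ v Sc' Sc)

data Ones : Set where
  none single several : Ones

addOne : Ones → Ones
addOne none = single
addOne single = several
addOne several = several

ones : ∀ {p} → BinStr p → Ones
ones [] = none
ones (false ∷ v) = ones v
ones (true ∷ v) = addOne (ones v)

ones-0s : ∀ p → ones (0s {p}) ≡ none
ones-0s zero = refl
ones-0s (suc p) = ones-0s p

ones-none : ∀ {p} (v : BinStr p) → ones v ≡ none → v ≡ 0s
ones-none [] _ = refl
ones-none (false ∷ v) e = cong (false ∷_) (ones-none v e)
ones-none (true ∷ v) e with ones v
ones-none (true ∷ v) () | none
ones-none (true ∷ v) () | single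
ones-none (true ∷ v) () | several

addOne-nonzero : ∀ {w} → w ≢ none → addOne w ≡ several
addOne-nonzero {none} w≢none = ⊥-elim (w≢none refl)
addOne-nonzero {single} _ = refl
addOne-nonzero {several} _ = refl

addOne-single : ∀ {w} → addOne w ≡ single → w ≡ none
addOne-single {none} _ = refl

addOne-several : ∀ {w} → addOne w ≡ several → w ≢ none
addOne-several {single} _ ()
addOne-several {several} _ ()

-- The unit vectors of length p, and the K p strings with several ones, listed
-- by their first bit.  Together, LV p lists every nonzero string exactly once,
-- with the unit vectors last.
U : ∀ p → Vec (BinStr p) p
U zero = []
U (suc p) = (true ∷ 0s) ∷ map (false ∷_) (U p)

K : ℕ → ℕ
K zero = 0
K (suc p) = K p + (K p + p)

D : ∀ p → Vec (BinStr p) (K p)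
LV : ∀ p → Vec (BinStr p) (K p + p)

D zero = []
D (suc p) = map (false ∷_) (D p) ++ map (true ∷_) (LV p)
LV p = D p ++ U p

K-arith : ∀ a q → (a + (a + q)) + suc q ≡ suc ((a + q) + (a + q))
K-arith = solve-∀

K-pow : ∀ p → suc (K p + p) ≡ 2 ^ p
K-pow zero = refl
K-pow (suc p) = begin
  suc (K (suc p) + suc p)             ≡⟨ cong suc (K-arith (K p) p) ⟩
  suc (suc ((K p + p) + (K p + p)))   ≡⟨ cong suc (+-suc (K p + p) (K p + p)) ⟨
  suc (K p + p) + suc (K p + p)       ≡⟨ cong₂ _+_ (K-pow p) (trans (K-pow p) (sym (+-identityʳ (2 ^ p)))) ⟩
  2 ^ p + (2 ^ p + 0)                 ∎
  where open ≡-Reasoning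

U-single : ∀ p → VAll.All (λ v → ones v ≡ single) (U p)
U-single zero = VAll.[]
U-single (suc p) = cong addOne (ones-0s p) VAll.∷ VAllₚ.map⁺ (U-single p)

D-several : ∀ p → VAll.All (λ v → ones v ≡ several) (D p)
LV-nonzero : ∀ p → VAll.All (λ v → ones v ≢ none) (LV p)

D-several zero = VAll.[]
D-several (suc p) =
  VAllₚ.++⁺ (VAllₚ.map⁺ (D-several p)) (VAllₚ.map⁺ (VAll.map addOne-nonzero (LV-nonzero p)))
LV-nonzero p = VAllₚ.++⁺ (VAll.map (λ e e' → several≢none (trans (sym e) e')) (D-several p))
                         (VAll.map (λ e e' → single≢none (trans (sym e) e')) (U-single p))
  where
    several≢none : several ≢ none
    several≢none ()
    single≢none : single ≢ none
    single≢none ()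

U-complete : ∀ {p} (v : BinStr p) → ones v ≡ single → v ∈ᵛ U p
U-complete (true ∷ v) e rewrite ones-none v (addOne-single e) = hereᵛ refl
U-complete (false ∷ v) e = thereᵛ (∈ᵛ-map⁺ (false ∷_) (U-complete v e))

D-complete : ∀ {p} (v : BinStr p) → ones v ≡ several → v ∈ᵛ D p
LV-complete : ∀ {p} (v : BinStr p) → ones v ≢ none → v ∈ᵛ LV p

D-complete {suc p} (false ∷ v) e = ∈ᵛ-++⁺ˡ (∈ᵛ-map⁺ (false ∷_) (D-complete v e))
D-complete {suc p} (true ∷ v) e =
  ∈ᵛ-++⁺ʳ (map (false ∷_) (D p)) (∈ᵛ-map⁺ (true ∷_) (LV-complete v (addOne-several e)))
LV-complete {p} v v≢0 with ones v in eq
... | none = ⊥-elim (v≢0 refl)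
... | single = ∈ᵛ-++⁺ʳ (D p) (U-complete v eq)
... | several = ∈ᵛ-++⁺ˡ (D-complete v eq)

heads-differ : ∀ {p m k} (xs : Vec (BinStr p) m) (ys : Vec (BinStr p) k) →
               VAll.All (λ u → VAll.All (u ≢_) (map (true ∷_) ys)) (map (false ∷_) xs)
heads-differ xs ys = VAllₚ.map⁺ (VAll.universal (λ _ → VAllₚ.map⁺ (VAll.universal (λ _ ()) ys)) xs)

U-unique : ∀ p → UniqueV (U p)
U-unique zero = []ᵖ
U-unique (suc p) = VAllₚ.map⁺ (VAll.universal (λ _ ()) (U p)) ∷ᵖ UniqueVₚ.map⁺ ∷-injectiveʳ (U-unique p)

D-unique : ∀ p → UniqueV (D p)
LV-unique : ∀ p → UniqueV (LV p)

D-unique zero = []ᵖ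
D-unique (suc p) = VAllPairsₚ.++⁺ (UniqueVₚ.map⁺ ∷-injectiveʳ (D-unique p))
                                 (UniqueVₚ.map⁺ ∷-injectiveʳ (LV-unique p))
                                 (heads-differ (D p) (LV p))
LV-unique p = VAllPairsₚ.++⁺ (D-unique p) (U-unique p)
  (VAll.map (λ u-several → VAll.map (λ v-single u≡v → several≢single
                (trans (sym u-several) (trans (cong ones u≡v) v-single))) (U-single p))
            (D-several p))
  where
    several≢single : several ≢ single
    several≢single ()

lab-injective : ∀ p (i j : Fin (K p + p)) → lookup (LV p) i ≡ lookup (LV p) j → i ≡ j
lab-injective p = lookup-injective (LV-unique p)

lab-nonzero : ∀ p (i : Fin (K p + p)) → lookup (LV p) i ≢ 0s
lab-nonzero p i lᵢ≡0 = VAllₚ.lookup⁺ (LV-nonzero p) i (trans (cong ones lᵢ≡0) (ones-0s p))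

lab-surjective : ∀ p (s : BinStr p) → s ≢ 0s → ∃ λ i → lookup (LV p) i ≡ s
lab-surjective p s s≢0 = index s∈LV , sym (lookup-index s∈LV)
  where
    s∈LV : s ∈ᵛ LV p
    s∈LV = LV-complete s (λ e → s≢0 (ones-none s e))

-- The unit vectors form the identity part of the parity-check matrix.
syn-U : ∀ {p} (c : BinStr p) → syn (U p) c ≡ c
syn-U [] = refl
syn-U {suc p} (true ∷ c) =
  trans (cong ((true ∷ 0s) ⊕_) (trans (syn-map-false (U p) c) (cong (false ∷_) (syn-U c))))
        (cong (true ∷_) (⊕-identityˡ c))
syn-U {suc p} (false ∷ c) = trans (syn-map-false (U p) c) (cong (false ∷_) (syn-U c))

replicate-++ : ∀ {A : Set} (a b : ℕ) (x : A) → replicate (a + b) x ≡ replicate a x ++ replicate b x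
replicate-++ zero b x = refl
replicate-++ (suc a) b x = cong (x ∷_) (replicate-++ a b x)

-- The sum of all nonzero strings of length p ≥ 2 vanishes, i.e. 1ⁿ is a
-- codeword.  The first bit of the sum over D (suc p) is the parity of the
-- number 2^p - 1 of strings in LV p, which is odd for p ≥ 1; the remaining
-- bits sum to 1ᵖ, which the unit vectors cancel.
syn-LV-ones : ∀ p → syn (LV p) 1s ≡ syn (D p) 1s ⊕ 1s
syn-LV-ones p = begin
  syn (LV p) 1s                             ≡⟨ cong (syn (LV p)) (replicate-++ (K p) p true) ⟩
  syn (D p ++ U p) (1s {K p} ++ 1s {p})     ≡⟨ syn-++ (D p) (U p) 1s 1s ⟩
  syn (D p) 1s ⊕ syn (U p) 1s               ≡⟨ cong (syn (D p) 1s ⊕_) (syn-U 1s) ⟩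
  syn (D p) 1s ⊕ 1s                         ∎
  where open ≡-Reasoning

syn-D-ones : ∀ p → syn (D (suc p)) 1s ≡ isOdd (K p + p) ∷ 1s
syn-D-ones p = begin
  syn (D (suc p)) 1s
    ≡⟨ cong (syn (D (suc p))) (replicate-++ (K p) (K p + p) true) ⟩
  syn (map (false ∷_) (D p) ++ map (true ∷_) (LV p)) (1s {K p} ++ 1s {K p + p})
    ≡⟨ syn-++ (map (false ∷_) (D p)) (map (true ∷_) (LV p)) 1s 1s ⟩
  syn (map (false ∷_) (D p)) 1s ⊕ syn (map (true ∷_) (LV p)) 1s
    ≡⟨ cong₂ _⊕_ (syn-map-false (D p) 1s) (trans (syn-map-true-ones (LV p)) (cong (isOdd (K p + p) ∷_) (syn-LV-ones p))) ⟩
  (false ∷ syn (D p) 1s) ⊕ (isOdd (K p + p) ∷ (syn (D p) 1s ⊕ 1s))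
    ≡⟨ cong (isOdd (K p + p) ∷_) (⊕-cancelˡ (syn (D p) 1s) 1s) ⟩
  isOdd (K p + p) ∷ 1s
    ∎
  where open ≡-Reasoning

isOdd-double : ∀ m → isOdd (m + m) ≡ false
isOdd-double zero = refl
isOdd-double (suc m) rewrite +-suc m m = trans (not-involutive (isOdd (m + m))) (isOdd-double m)

LV-length-odd : ∀ q → isOdd (K (suc q) + suc q) ≡ true
LV-length-odd q rewrite K-arith (K q) q = cong not (isOdd-double (K q + q))

syn-D-ones-≥2 : ∀ q → syn (D (suc (suc q))) 1s ≡ 1s
syn-D-ones-≥2 q = trans (syn-D-ones (suc q)) (cong (_∷ 1s) (LV-length-odd q))

allStrings : ∀ k → List (BinStr k)
allStrings zero = [] ∷ˡ []ˡ
allStrings (suc k) = mapˡ (false ∷_) (allStrings k) ++ˡ mapˡ (true ∷_) (allStrings k)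

allButOnes : ∀ k → List (BinStr k)
allButOnes zero = []ˡ
allButOnes (suc k) = mapˡ (false ∷_) (allStrings k) ++ˡ mapˡ (true ∷_) (allButOnes k)

allStrings-complete : ∀ {k} (d : BinStr k) → d ∈ allStrings k
allStrings-complete [] = hereˡ refl
allStrings-complete {suc k} (false ∷ d) = ∈-++⁺ˡ (∈-map⁺ (false ∷_) (allStrings-complete d))
allStrings-complete {suc k} (true ∷ d) =
  ∈-++⁺ʳ (mapˡ (false ∷_) (allStrings k)) (∈-map⁺ (true ∷_) (allStrings-complete d))

allButOnes-complete : ∀ {k} (d : BinStr k) → d ≢ 1s → d ∈ allButOnes k
allButOnes-complete [] d≢1s = ⊥-elim (d≢1s refl)
allButOnes-complete {suc k} (false ∷ d) _ = ∈-++⁺ˡ (∈-map⁺ (false ∷_) (allStrings-complete d))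
allButOnes-complete {suc k} (true ∷ d) d≢1s =
  ∈-++⁺ʳ (mapˡ (false ∷_) (allStrings k)) (∈-map⁺ (true ∷_) (allButOnes-complete d (d≢1s ∘′ cong (true ∷_))))

allButOnes-sound : ∀ k → LAll.All (_≢ 1s) (allButOnes k)
allButOnes-sound zero = LAll.[]
allButOnes-sound (suc k) =
  LAllₚ.++⁺ (LAllₚ.map⁺ (LAll.universal (λ _ ()) (allStrings k)))
            (LAllₚ.map⁺ (LAll.map (λ d≢1s e → d≢1s (∷-injectiveʳ e)) (allButOnes-sound k)))

heads-disjoint : ∀ {k} (xs ys : List (BinStr k)) {v} → v ∈ mapˡ (false ∷_) xs × v ∈ mapˡ (true ∷_) ys → ⊥
heads-disjoint xs ys (v∈xs , v∈ys) with ∈-map⁻ (false ∷_) v∈xs | ∈-map⁻ (true ∷_) v∈ys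
... | _ , _ , refl | _ , _ , ()

allStrings-unique : ∀ k → Unique (allStrings k)
allStrings-unique zero = LAll.[] ∷ˡᵖ []ˡᵖ
allStrings-unique (suc k) =
  Uniqueₚ.++⁺ (Uniqueₚ.map⁺ ∷-injectiveʳ (allStrings-unique k)) (Uniqueₚ.map⁺ ∷-injectiveʳ (allStrings-unique k))
              (heads-disjoint (allStrings k) (allStrings k))

allButOnes-unique : ∀ k → Unique (allButOnes k)
allButOnes-unique zero = []ˡᵖ
allButOnes-unique (suc k) =
  Uniqueₚ.++⁺ (Uniqueₚ.map⁺ ∷-injectiveʳ (allStrings-unique k)) (Uniqueₚ.map⁺ ∷-injectiveʳ (allButOnes-unique k))
              (heads-disjoint (allStrings k) (allButOnes k))

length-map₂ : ∀ {k} (xs ys : List (BinStr k)) →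
              length (mapˡ (false ∷_) xs ++ˡ mapˡ (true ∷_) ys) ≡ length xs + length ys
length-map₂ xs ys = trans (length-++ (mapˡ (false ∷_) xs)) (cong₂ _+_ (length-map _ xs) (length-map _ ys))

allStrings-length : ∀ k → length (allStrings k) ≡ 2 ^ k
allStrings-length zero = refl
allStrings-length (suc k) =
  trans (length-map₂ (allStrings k) (allStrings k))
        (cong₂ _+_ (allStrings-length k) (trans (allStrings-length k) (sym (+-identityʳ _))))

allButOnes-length : ∀ k → length (allButOnes k) ≡ 2 ^ k ∸ 1
allButOnes-length zero = refl
allButOnes-length (suc k) = begin
  length (allButOnes (suc k))    ≡⟨ length-map₂ (allStrings k) (allButOnes k) ⟩
  length (allStrings k) + length (allButOnes k)
                                 ≡⟨ cong₂ _+_ (allStrings-length k) (allButOnes-length k) ⟩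
  2 ^ k + (2 ^ k ∸ 1)            ≡⟨ +-∸-assoc (2 ^ k) (m^n>0 2 k) ⟨
  (2 ^ k + 2 ^ k) ∸ 1            ≡⟨ cong (λ z → (2 ^ k + z) ∸ 1) (+-identityʳ (2 ^ k)) ⟨
  2 ^ suc k ∸ 1                  ∎
  where open ≡-Reasoning

zeros : ∀ {m} → BinStr m → ℕ
zeros [] = 0
zeros (true ∷ x) = zeros x
zeros (false ∷ x) = suc (zeros x)

zeros-≤ : ∀ {m} (x : BinStr m) → zeros x ≤ m
zeros-≤ [] = z≤n
zeros-≤ (true ∷ x) = ≤-trans (zeros-≤ x) (n≤1+n _)
zeros-≤ (false ∷ x) = s≤s (zeros-≤ x)

zeros-∷ʳ : ∀ {m} (x : BinStr m) b → zeros (x ∷ʳ b) ≡ zeros (b ∷ x)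
zeros-∷ʳ [] b = refl
zeros-∷ʳ (true ∷ x) true = zeros-∷ʳ x true
zeros-∷ʳ (true ∷ x) false = zeros-∷ʳ x false
zeros-∷ʳ (false ∷ x) true = cong suc (zeros-∷ʳ x true)
zeros-∷ʳ (false ∷ x) false = cong suc (zeros-∷ʳ x false)

zeros-circulation : ∀ {m} (i : Fin m) (x : BinStr m) → zeros (circulation i x) ≡ zeros x
zeros-circulation i = zeros-rotlBy (toℕ i)
  where
    zeros-rotlBy : ∀ {m} r (x : BinStr m) → zeros (rotlBy r x) ≡ zeros x
    zeros-rotlBy zero x = refl
    zeros-rotlBy (suc r) [] = zeros-rotlBy r []
    zeros-rotlBy (suc r) (b ∷ x) = trans (zeros-rotlBy r (x ∷ʳ b)) (zeros-∷ʳ x b)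

zeros-prefix : ∀ {s m} {w : BinStr m} → IsPrefix (replicate s true) w → zeros w + s ≤ m
zeros-prefix {w = w} pre[] = ≤-trans (≤-reflexive (+-identityʳ _)) (zeros-≤ w)
zeros-prefix {suc s} {suc m} {true ∷ w} (pre∷ true pr) =
  ≤-trans (≤-reflexive (+-suc (zeros w) s)) (s≤s (zeros-prefix pr))

zeros-substring : ∀ {s m} {w : BinStr m} → IsSubstring (replicate s true) w → zeros w + s ≤ m
zeros-substring (here pr) = zeros-prefix pr
zeros-substring {s} {suc m} (there true sub) = ≤-trans (zeros-substring sub) (n≤1+n m)
zeros-substring {s} {suc m} (there false sub) = s≤s (zeros-substring sub)

-- Hence, when n ≤ 2 + s, a string having a circulation that contains 1ˢ has
-- at most two zeros: strings with three or more zeros are vertices of Λ_n(1^s).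
circulation-witness-zeros : ∀ {n s} {x : BinStr n} (i : Fin n) →
  n ≤ 2 + s → IsSubstring (replicate s true) (circulation i x) → zeros x ≤ 2
circulation-witness-zeros {n} {s} {x} i n≤2+s sub =
  +-cancelʳ-≤ s (zeros x) 2
    (≤-trans (≤-trans (≤-reflexive (cong (_+ s) (sym (zeros-circulation i x)))) (zeros-substring sub)) n≤2+s)

oneZero-shape : ∀ {m} (x : BinStr m) → zeros x ≤ 1 → x ≡ 1s ⊎ ∃ λ i → x ≡ flip 1s i
oneZero-shape [] _ = inj₁ refl
oneZero-shape (true ∷ x) h with oneZero-shape x h
... | inj₁ x≡1s = inj₁ (cong (true ∷_) x≡1s)
... | inj₂ (i , x≡f) = inj₂ (suc i , cong (true ∷_) x≡f)
oneZero-shape (false ∷ x) (s≤s h) = inj₂ (zero , cong (false ∷_) (noZero x h))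
  where
    noZero : ∀ {m} (x : BinStr m) → zeros x ≤ 0 → x ≡ 1s
    noZero [] _ = refl
    noZero (true ∷ x) h = cong (true ∷_) (noZero x h)

twoZeros-shape : ∀ {m} (x : BinStr m) → zeros x ≤ 2 →
  x ≡ 1s ⊎ (∃ λ i → x ≡ flip 1s i) ⊎ (∃ λ i → ∃ λ j → i ≢ j × x ≡ flip (flip 1s i) j)
twoZeros-shape [] _ = inj₁ refl
twoZeros-shape (true ∷ x) h with twoZeros-shape x h
... | inj₁ x≡1s = inj₁ (cong (true ∷_) x≡1s)
... | inj₂ (inj₁ (i , x≡f)) = inj₂ (inj₁ (suc i , cong (true ∷_) x≡f))
... | inj₂ (inj₂ (i , j , i≢j , x≡ff)) =
  inj₂ (inj₂ (suc i , suc j , i≢j ∘′ fsuc-injective , cong (true ∷_) x≡ff))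
twoZeros-shape (false ∷ x) (s≤s h) with oneZero-shape x h
... | inj₁ x≡1s = inj₂ (inj₁ (zero , cong (false ∷_) x≡1s))
... | inj₂ (i , x≡f) = inj₂ (inj₂ (suc i , zero , (λ ()) , cong (false ∷_) x≡f))

flip-∷ʳ : ∀ {m} (x : BinStr m) (j : Fin m) b → flip x j ∷ʳ b ≡ flip (x ∷ʳ b) (inject₁ j)
flip-∷ʳ (a ∷ x) zero b = refl
flip-∷ʳ (a ∷ x) (suc j) b = cong (a ∷_) (flip-∷ʳ x j b)

ones-∷ʳ : ∀ m → 1s {m} ∷ʳ true ≡ 1s
ones-∷ʳ zero = refl
ones-∷ʳ (suc m) = cong (true ∷_) (ones-∷ʳ m)

rotate-singleZero : ∀ {m} r (i : Fin (suc m)) → toℕ i ≡ r → rotlBy r (flip 1s i) ≡ false ∷ 1s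
rotate-singleZero zero zero _ = refl
rotate-singleZero {suc m} (suc r) (suc j) i≡r = begin
  rotlBy r ((flip 1s j) ∷ʳ true)     ≡⟨ cong (rotlBy r) (flip-∷ʳ 1s j true) ⟩
  rotlBy r (flip (1s ∷ʳ true) (inject₁ j))
                                     ≡⟨ cong (λ y → rotlBy r (flip y (inject₁ j))) (ones-∷ʳ (suc m)) ⟩
  rotlBy r (flip 1s (inject₁ j))     ≡⟨ rotate-singleZero r (inject₁ j) (trans (toℕ-inject₁ j) (suc-injective i≡r)) ⟩
  false ∷ 1s                         ∎
  where open ≡-Reasoning

ones-prefix : ∀ {s m} → s ≤ m → IsPrefix (replicate s true) (replicate m true)
ones-prefix z≤n = pre[]
ones-prefix (s≤s h) = pre∷ true (ones-prefix h)

ones-notInLucas : ∀ {n s} → s < n → ¬ InLucas n s 1s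
ones-notInLucas (s≤s s≤m) L = L zero (here (ones-prefix (≤-trans s≤m (n≤1+n _))))

singleZero-notInLucas : ∀ {n s} → s < n → (i : Fin n) → ¬ InLucas n s (flip 1s i)
singleZero-notInLucas (s≤s s≤m) i L =
  L i (subst (IsSubstring (replicate _ true)) (sym (rotate-singleZero (toℕ i) i refl))
             (there false (here (ones-prefix s≤m))))

nearOnes-notInLucas : ∀ {n s} {v : BinStr n} → s < n → Within1 v 1s → ¬ InLucas n s v
nearOnes-notInLucas {v = v} s<n v~1s with within1-cases v~1s
... | inj₁ 1s≡v = subst (λ y → ¬ InLucas _ _ y) 1s≡v (ones-notInLucas s<n)
... | inj₂ (i , 1s≡fv) =
  subst (λ y → ¬ InLucas _ _ y) (trans (cong (λ y → flip y i) 1s≡fv) (flip-involutive v i))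
        (singleZero-notInLucas s<n i)

module HammingCode (q : ℕ) where

  p k n : ℕ
  p = suc (suc q)
  k = K p
  n = k + p

  open SyndromeDecoding (LV p) (lab-injective p) (lab-nonzero p) (lab-surjective p) public

  blockLength : 2 ^ p ∸ 1 ≡ n
  blockLength = cong (_∸ 1) (sym (K-pow p))

  S-ones : S 1s ≡ 0s
  S-ones = trans (syn-LV-ones p) (trans (cong (_⊕ 1s) (syn-D-ones-≥2 q)) (⊕-self 1s))

  codeword-zeros : ∀ {x} → S x ≡ 0s → zeros x ≤ 2 → x ≡ 1s
  codeword-zeros {x} Sx few with twoZeros-shape x few
  ... | inj₁ x≡1s = x≡1s
  ... | inj₂ (inj₁ (i , refl)) = ⊥-elim (flip-leaves-code S-ones i Sx)
  ... | inj₂ (inj₂ (i , j , i≢j , refl)) = ⊥-elim (i≢j (flips-differ (flip 1s i) S-back Sx))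
    where
      S-back : S (flip (flip 1s i) i) ≡ 0s
      S-back = trans (cong S (flip-involutive 1s i)) S-ones

  -- Systematic form: the last p positions carry the unit labels, so the
  -- codeword with information part d is d ++ syn (D p) d.
  S-split : ∀ (d : BinStr k) (c : BinStr p) → S (d ++ c) ≡ syn (D p) d ⊕ c
  S-split d c = trans (syn-++ (D p) (U p) d c) (cong (syn (D p) d ⊕_) (syn-U c))

  encode : BinStr k → BinStr n
  encode d = d ++ syn (D p) d

  encode-ones : encode 1s ≡ 1s
  encode-ones = trans (cong (1s ++_) (syn-D-ones-≥2 q)) (sym (replicate-++ k p true))

  C : List (BinStr n)
  C = mapˡ encode (allButOnes k)

  C-codewords : LAll.All (λ x → S x ≡ 0s × x ≢ 1s) C
  C-codewords = LAllₚ.map⁺ (LAll.map codeword (allButOnes-sound k))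
    where
      codeword : ∀ {d} → d ≢ 1s → S (encode d) ≡ 0s × encode d ≢ 1s
      codeword {d} d≢1s =
        trans (S-split d _) (⊕-self _) ,
        λ e → d≢1s (++-injectiveˡ d 1s (trans e (sym encode-ones)))

  C-complete : ∀ {x} → S x ≡ 0s → x ≢ 1s → x ∈ C
  C-complete {x} Sx x≢1s with splitAt k x
  ... | d , c , refl = subst (_∈ C) (cong (d ++_) parity) (∈-map⁺ encode (allButOnes-complete d d≢1s))
    where
      parity : syn (D p) d ≡ c
      parity = ⊕≡0⇒≡ _ _ (trans (sym (S-split d c)) Sx)
      d≢1s : d ≢ 1s
      d≢1s refl = x≢1s (trans (cong (1s ++_) (sym parity)) encode-ones)

  C-unique : Unique C
  C-unique = Uniqueₚ.map⁺ (λ {d} {d'} → ++-injectiveˡ d d') (allButOnes-unique k)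

  C-size : length C ≡ 2 ^ n / suc n ∸ 1
  C-size = begin
    length C                    ≡⟨ length-map encode (allButOnes k) ⟩
    length (allButOnes k)       ≡⟨ allButOnes-length k ⟩
    2 ^ k ∸ 1                   ≡⟨ cong (_∸ 1) (m*n/n≡m (2 ^ k) (suc n)) ⟨
    2 ^ k * suc n / suc n ∸ 1   ≡⟨ cong (λ z → 2 ^ k * z / suc n ∸ 1) (K-pow p) ⟩
    2 ^ k * 2 ^ p / suc n ∸ 1   ≡⟨ cong (λ z → z / suc n ∸ 1) (^-distribˡ-+-* 2 k p) ⟨
    2 ^ n / suc n ∸ 1           ∎
    where open ≡-Reasoning

  lucasPerfectCode : ∀ {s} → s < n → n ≤ 2 + s → IsPerfectCode n s C
  lucasPerfectCode {s} s<n n≤2+s = C-unique , LAll.map codeword-vertex C-codewords , cover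
    where
      codeword-vertex : ∀ {x} → S x ≡ 0s × x ≢ 1s → InLucas n s x
      codeword-vertex (Sx , x≢1s) i sub = x≢1s (codeword-zeros Sx (circulation-witness-zeros i n≤2+s sub))

      cover : ∀ v → InLucas n s v → Σ (BinStr n) λ c → (c ∈ C) × Within1 v c ×
                ((c' : BinStr n) → c' ∈ C → Within1 v c' → c' ≡ c)
      cover v L with decode v
      ... | c , Sc , v~c =
        c , C-complete Sc (λ c≡1s → nearOnes-notInLucas s<n (subst (Within1 v) c≡1s v~c) L) , v~c ,
        λ c' c'∈C v~c' → decode-unique Sc (proj₁ (LAll.lookup C-codewords c'∈C)) v~c v~c'

subtract-bounds : ∀ n t → 1 ≤ t → t ≤ n → t ≤ 2 → n ∸ t < n × n ≤ 2 + (n ∸ t)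
subtract-bounds n t 1≤t t≤n t≤2 = ∸-monoʳ-< 1≤t t≤n , ≤-trans (m≤n+m∸n n t) (+-monoˡ-≤ (n ∸ t) t≤2)

mainTheorem5 : (p : ℕ) → 2 ≤ p → (n : ℕ) → n ≡ 2 ^ p ∸ 1 →
    (Σ (List (BinStr n)) λ C → IsPerfectCode n (n ∸ 1) C × length C ≡ 2 ^ n / suc n ∸ 1) ×
    (Σ (List (BinStr n)) λ C → IsPerfectCode n (n ∸ 2) C × length C ≡ 2 ^ n / suc n ∸ 1)
-- With p = q + 2 and n = 2^p - 1, both s = n - 1 and s = n - 2 lie in the
-- range of lucasPerfectCode, and C has the required size.
mainTheorem5 (suc (suc q)) (s≤s (s≤s z≤n)) n n≡2^p-1 with trans n≡2^p-1 (HammingCode.blockLength q)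
... | refl = (C , perfectFor 1 ≤-refl (s≤s z≤n) , C-size) , (C , perfectFor 2 (s≤s z≤n) ≤-refl , C-size)
  where
    open HammingCode q using (C; C-size; lucasPerfectCode)
    2≤n : 2 ≤ n
    2≤n = ≤-trans (s≤s (s≤s z≤n)) (m≤n+m (suc (suc q)) (K (suc (suc q))))
    perfectFor : ∀ t → 1 ≤ t → t ≤ 2 → IsPerfectCode n (n ∸ t) C
    perfectFor t 1≤t t≤2 =
      let (s<n , n≤2+s) = subtract-bounds n t 1≤t (≤-trans t≤2 2≤n) t≤2 in lucasPerfectCode s<n n≤2+s
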